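{- Let $\mathcal{T}=((t,u),\mathcal{O},\mathcal{R})$ be a tiling, $r$ a row and $S$ a nonempty subset of the nonempty cells of row $r$ such that row separation applies to $(r,S)$. Let $h,g\in\operatorname{Grid}(\mathcal{T})$ and suppose $\Gamma(h)\le\Gamma(g)$. Then $h\le g$.
   Context: A gridded permutation of size $n$ is a pair $(\pi,(c_1,\ldots,c_n))$ with $\pi$ a permutation of $\{1,\ldots,n\}$ and cells $c_i=(x_i,y_i)\in\mathbb{N}^2$ such that $x_i\le x_j$ whenever $i<j$ and $y_i\le y_j$ whenever $\pi(i)<\pi(j)$; $\mathcal{G}^{(t,u)}$ is the set of those with all cells in $\{0,\ldots,t-1\}\times\{0,\ldots,u-1\}$. Containment $h\le g$: some subsequence of $g$'s permutation is order-isomorphic to $h$'s permutation and the corresponding cells of $g$ equal the cells of $h$. A tiling $\mathcal{T}=((t,u),\mathcal{O},\mathcal{R})$ has obstructions $\mathcal{O}$ and requirement lists $\mathcal{R}$; $\operatorname{Grid}(\mathcal{T})$ is the set of elements of $\mathcal{G}^{(t,u)}$ avoiding every obstruction and containing at least one element of each requirement list. A cell $c$ is empty if $(1,(c))\in\mathcal{O}$, nonempty otherwise. Given row $r$ and $S$, let $S'$ be the remaining nonempty cells of row $r$. Row separation applies if for every $(c_1,c_2)\in S\times S'$: if $c_1$ is in a column left of $c_2$ then $(21,(c_1,c_2))\in\mathcal{O}$, and if $c_1$ is in a column right of $c_2$ then $(12,(c_2,c_1))\in\mathcal{O}$. Define $\gamma(i,j)=(i,j)$ if $j<r$, or if $j=r$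 and column $i$ contains a cell of $S$; and $\gamma(i,j)=(i,j+1)$ if $j>r$, or if $j=r$ and column $i$ contains no cell of $S$. Define $\Gamma((\pi,(c_1,\ldots,c_n)))=(\pi,(\gamma(c_1),\ldots,\gamma(c_n)))$. -}

module Defs where

open import Data.Nat using (ℕ; _<_; _≤_)
open import Data.Nat.Properties using (_≟_; _<?_)
open import Data.Fin using (Fin; toℕ) renaming (zero to fz; suc to fs)
open import Data.Vec using (Vec; lookup; map; []; _∷_)
open import Data.Product using (_×_; _,_; proj₁; proj₂; Σ; ∃)
open import Data.List using (List; [])
open import Data.List.Relation.Unary.All using (All)
open import Data.List.Relation.Unary.Any using (Any; any?)
open import Data.List.Membership.Propositional using (_∈_; _∉_)
open import Function.Definitions using (Injective)
open import Function.Bundles using (_⇔_)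
open import Relation.Binary.PropositionalEquality using (_≡_)
open import Relation.Nullary using (¬_; yes; no)

Cell : Set
Cell = ℕ × ℕ

-- A (not necessarily valid) pair (π , (c₁,…,cₙ)): π is given by its
-- vector of values (0-based), cells by a vector of cells.
record GP : Set where
  constructor gp
  field
    size  : ℕ
    perm  : Vec (Fin size) size
    cells : Vec Cell size
open GP public

π : (g : GP) → Fin (size g) → ℕ
π g i = toℕ (lookup (perm g) i)

cell : (g : GP) → Fin (size g) → Cell
cell g i = lookup (cells g) i

IsPerm : GP → Set
IsPerm g = Injective _≡_ _≡_ (lookup (perm g))

IsGridded : GP → Set
IsGridded g = IsPerm g
  × (∀ i j → toℕ i < toℕ j → proj₁ (cell g i) ≤ proj₁ (cell g j))
  × (∀ i j → π g i < π g j → proj₂ (cell g i) ≤ proj₂ (cell g j))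

InG : ℕ → ℕ → GP → Set
InG t u g = IsGridded g × (∀ i → proj₁ (cell g i) < t × proj₂ (cell g i) < u)

_≼_ : GP → GP → Set
h ≼ g = Σ (Fin (size h) → Fin (size g)) λ σ →
    (∀ i j → toℕ i < toℕ j → toℕ (σ i) < toℕ (σ j))
  × (∀ i j → (π h i < π h j) ⇔ (π g (σ i) < π g (σ j)))
  × (∀ i → cell g (σ i) ≡ cell h i)

record Tiling : Set where
  constructor tiling
  field
    width  : ℕ
    height : ℕ
    obs    : List GP
    reqs   : List (List GP)
open Tiling public

Grid : Tiling → GP → Set
Grid T g = InG (width T) (height T) g
  × All (λ o → ¬ (o ≼ g)) (obs T)
  × All (λ L → Any (λ q → q ≼ g) L) (reqs T)

point : Cell → GP
point c = gp 1 (fz ∷ []) (c ∷ [])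

ob21 : Cell → Cell → GP
ob21 c₁ c₂ = gp 2 (fs fz ∷ fz ∷ []) (c₁ ∷ c₂ ∷ [])

ob12 : Cell → Cell → GP
ob12 c₁ c₂ = gp 2 (fz ∷ fs fz ∷ []) (c₁ ∷ c₂ ∷ [])

EmptyCell : Tiling → Cell → Set
EmptyCell T c = point c ∈ obs T

NonemptyCell : Tiling → Cell → Set
NonemptyCell T c = ¬ EmptyCell T c

NonemptyInRow : Tiling → ℕ → Cell → Set
NonemptyInRow T r c = proj₂ c ≡ r × proj₁ c < width T × NonemptyCell T c

RowSeparation : Tiling → ℕ → List Cell → Set
RowSeparation T r S = ∀ c₁ c₂ → c₁ ∈ S → NonemptyInRow T r c₂ → c₂ ∉ S →
    (proj₁ c₁ < proj₁ c₂ → ob21 c₁ c₂ ∈ obs T)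
  × (proj₁ c₂ < proj₁ c₁ → ob12 c₂ c₁ ∈ obs T)

γ : ℕ → List Cell → Cell → Cell
γ r S (i , j) with j <? r
... | yes _ = (i , j)
... | no _ with j ≟ r
...   | no _ = (i , ℕ.suc j)
...   | yes _ with any? (λ c → proj₁ c ≟ i) S
...     | yes _ = (i , j)
...     | no _ = (i , ℕ.suc j)

Γ : ℕ → List Cell → GP → GP
Γ r S (gp n p cs) = gp n p (map (γ r S) cs)

{-# OPTIONS --safe #-}
module Submission where

open import Defs
open import Data.Nat using (ℕ; _<_; _≤_; suc; pred; _≤?_)
open import Data.Nat.Properties using (_≟_; _<?_; <⇒≤; ≤-refl; ≮⇒≥; <⇒≱)
open import Data.List using (List; [])
open import Data.List.Relation.Unary.All using (All)
open import Data.List.Relation.Unary.Any using (any?)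
open import Data.Product using (_,_; proj₁; proj₂)
open import Data.Product.Properties using (×-≡,≡→≡)
open import Data.Vec using (map; lookup)
open import Data.Vec.Properties using (lookup-map)
open import Function using (_∘_)
open import Function.Definitions using (Injective)
open import Relation.Binary.PropositionalEquality
  using (_≡_; _≢_; refl; cong; module ≡-Reasoning)
open import Relation.Nullary using (yes; no; contradiction)

mapCells : (Cell → Cell) → GP → GP
mapCells f (gp n p cs) = gp n p (map f cs)

mapCells-reflects-≼ : ∀ {f} → Injective _≡_ _≡_ f →
  (h g : GP) → mapCells f h ≼ mapCells f g → h ≼ g
mapCells-reflects-≼ {f} f-inj (gp n p cs) (gp m q ds) (σ , mono , iso , same-cell) =
  σ , mono , iso , λ i → f-inj (begin
    f (lookup ds (σ i))      ≡⟨ lookup-map (σ i) f ds ⟨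
    lookup (map f ds) (σ i)  ≡⟨ same-cell i ⟩
    lookup (map f cs) i      ≡⟨ lookup-map i f cs ⟩
    f (lookup cs i)          ∎)
  where open ≡-Reasoning

γ-column : ∀ r S c → proj₁ (γ r S c) ≡ proj₁ c
γ-column r S (i , j) with j <? r
... | yes _ = refl
... | no _ with j ≟ r
...   | no _ = refl
...   | yes _ with any? (λ c → proj₁ c ≟ i) S
...     | yes _ = refl
...     | no _ = refl

unshiftRow : ℕ → ℕ → ℕ
unshiftRow r k with k ≤? r
... | yes _ = k
... | no _ = pred k

unshiftRow-≤ : ∀ {r k} → k ≤ r → unshiftRow r k ≡ k
unshiftRow-≤ {r} {k} k≤r with k ≤? r
... | yes _ = refl
... | no k≰r = contradiction k≤r k≰r

unshiftRow-suc : ∀ {r j} → r ≤ j → unshiftRow r (suc j) ≡ j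
unshiftRow-suc {r} {j} r≤j with suc j ≤? r
... | yes j<r = contradiction r≤j (<⇒≱ j<r)
... | no _ = refl

unshiftRow-γ : ∀ r S c → unshiftRow r (proj₂ (γ r S c)) ≡ proj₂ c
unshiftRow-γ r S (i , j) with j <? r
... | yes j<r = unshiftRow-≤ (<⇒≤ j<r)
... | no j≮r with j ≟ r
...   | no _ = unshiftRow-suc (≮⇒≥ j≮r)
...   | yes refl with any? (λ c → proj₁ c ≟ i) S
...     | yes _ = unshiftRow-≤ ≤-refl
...     | no _ = unshiftRow-suc ≤-refl

γ-injective : ∀ r S → Injective _≡_ _≡_ (γ r S)
γ-injective r S {c} {d} γc≡γd = ×-≡,≡→≡ (column , row)
  where
  open ≡-Reasoning
  column : proj₁ c ≡ proj₁ d
  column = begin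
    proj₁ c           ≡⟨ γ-column r S c ⟨
    proj₁ (γ r S c)   ≡⟨ cong proj₁ γc≡γd ⟩
    proj₁ (γ r S d)   ≡⟨ γ-column r S d ⟩
    proj₁ d           ∎
  row : proj₂ c ≡ proj₂ d
  row = begin
    proj₂ c                          ≡⟨ unshiftRow-γ r S c ⟨
    unshiftRow r (proj₂ (γ r S c))   ≡⟨ cong (unshiftRow r ∘ proj₂) γc≡γd ⟩
    unshiftRow r (proj₂ (γ r S d))   ≡⟨ unshiftRow-γ r S d ⟩
    proj₂ d                          ∎

lemma6p13 : (T : Tiling) (r : ℕ) (S : List Cell) →
    r < height T → S ≢ [] → All (NonemptyInRow T r) S →
    RowSeparation T r S →
    (h g : GP) → Grid T h → Grid T g →
    Γ r S h ≼ Γ r S g → h ≼ g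
lemma6p13 _ r S _ _ _ _ h g _ _ = mapCells-reflects-≼ (γ-injective r S) h g
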